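{- Let $m=2n+1\ge 5$ be odd, let $\varphi=(\mathcal A_1,\dots,\mathcal A_m)$ be a ring (as defined in the context), and let $i\in\{1,\dots,m\}$. For every set $S\in\Pi_i$: replacing the vertex of $S$ lying in $\mathcal A_i$ by any vertex of $\mathcal A_{i-1}$ yields a set in $\Pi_{i+2}$; and replacing the vertex of $S$ lying in $\mathcal A_{i-3}$ by any vertex of $\mathcal A_{i-2}$ yields a set in $\Pi_{i-2}$.
   Context: Indices are taken cyclically modulo $m$. A ring is a sequence $\varphi=(\mathcal A_1,\dots,\mathcal A_m)$ of pairwise disjoint finite vertex sets such that $|\mathcal A_i|\ge 1$ and $|\mathcal A_i|+|\mathcal A_{i+1}|\le m$ for all $i$, and $\sum_{i=1}^m|\mathcal A_i| = m\lfloor m/2\rfloor$. The ring graph has vertex set $\bigcup_i\mathcal A_i$, two distinct vertices $u\in\mathcal A_i$, $v\in\mathcal A_j$ being adjacent iff $j\in\{i-1,i,i+1\}$ mod $m$. For $i=1,\dots,m$, $\Pi_i$ is the family of all sets $\{v_0,\dots,v_{n-1}\}$ with $v_k\in\mathcal A_{i+2k}$ for $k=0,\dots,n-1$ (note $i+2(n-1)\equiv i-3$). -}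

module Defs where

open import Data.Nat using (ℕ; suc; _+_; _*_; _≤_; NonZero)
open import Data.Nat.DivMod using (_mod_; _/_)
open import Data.Fin using (Fin; toℕ)
open import Data.List using (List; length; map; allFin)
open import Data.Nat.ListAction using (sum)
open import Data.List.Membership.Propositional using (_∈_)
open import Data.List.Relation.Unary.Unique.Propositional using (Unique)
open import Data.Product using (Σ; ∃; _×_)
open import Data.Sum using (_⊎_)
open import Data.Empty using (⊥)
open import Relation.Binary.PropositionalEquality using (_≡_; _≢_)

-- Cyclic index: the natural number j read modulo m, as an element of Fin m.
-- Ring indices 1..m of the paper are represented by 0..m-1 (Fin m).
cyc : (m : ℕ) .{{_ : NonZero m}} → ℕ → Fin m
cyc m j = j mod m

record IsRing {V : Set} (m : ℕ) .{{_ : NonZero m}} (A : Fin m → List V) : Set where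
  field
    unique   : ∀ i → Unique (A i)
    disjoint : ∀ i j → i ≢ j → ∀ x → x ∈ A i → x ∈ A j → ⊥
    nonempty : ∀ i → 1 ≤ length (A i)
    adjacent : ∀ i → length (A i) + length (A (cyc m (suc (toℕ i)))) ≤ m
    total    : sum (map (λ i → length (A i)) (allFin m)) ≡ m * (m / 2)

-- Π_i (with parameter n): S ∈ Π_i iff S = {v_0,…,v_{n-1}} with v_k ∈ A_{i+2k}.
-- Vertex sets S are predicates on V; set equality is extensional.
Π : {V : Set} {m : ℕ} .{{_ : NonZero m}} (n : ℕ) (A : Fin m → List V) (i : Fin m)
    (S : V → Set) → Set
Π {V} {m} n A i S =
  Σ (Fin n → V) λ v →
    (∀ k → v k ∈ A (cyc m (toℕ i + 2 * toℕ k)))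
    × (∀ x → (S x → ∃ λ k → x ≡ v k) × ((∃ λ k → x ≡ v k) → S x))

replace : {V : Set} → (V → Set) → V → V → V → Set
replace S u w x = (S x × x ≢ u) ⊎ x ≡ w

-- A set of Π_i is listed by v₀,…,v_{n-1} with v_k ∈ A_{i+2k}. Since the classes are disjoint
-- and the n slots i+2k are distinct modulo m = 2n+1, the listing is injective and the vertex of
-- the set in A_i (resp. A_{i-3} = A_{i+2(n-1)}) is v₀ (resp. v_{n-1}). Dropping v₀ and appending
-- w ∈ A_{i-1} = A_{(i+2)+2(n-1)} lists the new set from slot i+2; dropping v_{n-1} and
-- prepending w ∈ A_{i-2} lists it from slot i-2, because (i-2)+2(k+1) ≡ i+2k.
module Submission where

open import Defs
open import Data.Nat using (ℕ; suc; _+_; _*_; _∸_; _≤_; _<_; NonZero; _%_)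
open import Data.Nat.Properties
  using (+-assoc; +-identityʳ; +-commutativeSemigroup; *-suc; *-cancelˡ-≡; *-monoʳ-<; <-≤-trans;
         m+[n∸m]≡n; <⇒≤; n≤1+n)
open import Data.Nat.DivMod
  using (m%n<n; m<n⇒m%n≡m; m%n%n≡m%n; %-distribˡ-+; [m+n]%n≡m%n; n%n≡0)
open import Algebra.Properties.CommutativeSemigroup +-commutativeSemigroup using (xy∙z≈xz∙y)
open import Data.Fin using (Fin; toℕ; fromℕ; punchIn; punchOut) renaming (zero to fzero; suc to fsuc)
open import Data.Fin.Properties
  using (toℕ-fromℕ<; toℕ-injective; toℕ<n; toℕ-fromℕ; punchInᵢ≢i; punchIn-punchOut)
  renaming (_≟_ to _≟ᶠ_)
open import Data.Vec.Functional using (insertAt; removeAt)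
open import Data.Vec.Functional.Properties using (insertAt-lookup; insertAt-punchIn; removeAt-punchOut)
open import Data.List using (List)
open import Data.List.Membership.Propositional using (_∈_)
open import Data.Product using (∃; _×_; _,_; proj₁; proj₂)
open import Data.Sum using (_⊎_; inj₁; inj₂)
open import Data.Empty using (⊥-elim)
open import Function.Definitions using (Injective)
open import Relation.Nullary using (yes; no)
open import Relation.Binary.PropositionalEquality
  using (_≡_; _≢_; refl; sym; trans; cong; subst; module ≡-Reasoning)
open import Data.Nat.Tactic.RingSolver using (solve-∀)
open ≡-Reasoning

module _ {m : ℕ} .{{_ : NonZero m}} where

  [m%d+n]%d≡[m+n]%d : ∀ a b → (a % m + b) % m ≡ (a + b) % m
  [m%d+n]%d≡[m+n]%d a b = begin
    (a % m + b) % m         ≡⟨ %-distribˡ-+ (a % m) b m ⟩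
    (a % m % m + b % m) % m ≡⟨ cong (λ x → (x + b % m) % m) (m%n%n≡m%n a m) ⟩
    (a % m + b % m) % m     ≡⟨ %-distribˡ-+ a b m ⟨
    (a + b) % m             ∎

  %-cancelˡ-+ : ∀ c {a b} → (c + a) % m ≡ (c + b) % m → a % m ≡ b % m
  %-cancelˡ-+ c {a} {b} e = begin
    a % m                 ≡⟨ undo a ⟨
    ((c + a) % m + d) % m ≡⟨ cong (λ x → (x + d) % m) e ⟩
    ((c + b) % m + d) % m ≡⟨ undo b ⟩
    b % m                 ∎
    where
    d = m ∸ c % m
    undo : ∀ x → ((c + x) % m + d) % m ≡ x % m
    undo x = begin
      ((c + x) % m + d) % m       ≡⟨ [m%d+n]%d≡[m+n]%d (c + x) d ⟩
      (c + x + d) % m             ≡⟨ cong (_% m) (xy∙z≈xz∙y c x d) ⟩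
      (c + d + x) % m             ≡⟨ [m%d+n]%d≡[m+n]%d (c + d) x ⟨
      ((c + d) % m + x) % m       ≡⟨ cong (λ y → (y + x) % m) ([m%d+n]%d≡[m+n]%d c d) ⟨
      ((c % m + d) % m + x) % m   ≡⟨ cong (λ y → (y % m + x) % m) (m+[n∸m]≡n (<⇒≤ (m%n<n c m))) ⟩
      (m % m + x) % m             ≡⟨ cong (λ y → (y + x) % m) (n%n≡0 m) ⟩
      x % m                       ∎

  toℕ-cyc : ∀ a → toℕ (cyc m a) ≡ a % m
  toℕ-cyc a = toℕ-fromℕ< (m%n<n a m)

  cyc-cong-% : ∀ {a b} → a % m ≡ b % m → cyc m a ≡ cyc m b
  cyc-cong-% {a} {b} e = toℕ-injective (trans (toℕ-cyc a) (trans e (sym (toℕ-cyc b))))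

  cyc-injective-% : ∀ {a b} → cyc m a ≡ cyc m b → a % m ≡ b % m
  cyc-injective-% {a} {b} e = trans (sym (toℕ-cyc a)) (trans (cong toℕ e) (toℕ-cyc b))

  cyc-toℕ+0 : ∀ (i : Fin m) → cyc m (toℕ i + 0) ≡ i
  cyc-toℕ+0 i = toℕ-injective (begin
    toℕ (cyc m (toℕ i + 0)) ≡⟨ toℕ-cyc (toℕ i + 0) ⟩
    (toℕ i + 0) % m         ≡⟨ cong (_% m) (+-identityʳ (toℕ i)) ⟩
    toℕ i % m               ≡⟨ m<n⇒m%n≡m (toℕ<n i) ⟩
    toℕ i                   ∎)

  cyc-absorb : ∀ a b → cyc m (toℕ (cyc m a) + b) ≡ cyc m (a + b)
  cyc-absorb a b = cyc-cong-% (trans (cong (λ x → (x + b) % m) (toℕ-cyc a)) ([m%d+n]%d≡[m+n]%d a b))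

  cyc-+-modulus : ∀ a → cyc m (a + m) ≡ cyc m a
  cyc-+-modulus a = cyc-cong-% ([m+n]%n≡m%n a m)

  slot : ∀ {n} → Fin m → Fin n → Fin m
  slot i k = cyc m (toℕ i + 2 * toℕ k)

  slot-via-toℕ : ∀ {n} i {k : Fin n} {t} → toℕ k ≡ t → slot i k ≡ cyc m (toℕ i + 2 * t)
  slot-via-toℕ i = cong (λ t → cyc m (toℕ i + 2 * t))

  slot-injective : ∀ {n} → 2 * n ≤ m → (i : Fin m) → Injective _≡_ _≡_ (slot {n} i)
  slot-injective 2n≤m i {k} {l} e = toℕ-injective (*-cancelˡ-≡ (toℕ k) (toℕ l) 2 (begin
    2 * toℕ k       ≡⟨ m<n⇒m%n≡m (below k) ⟨
    2 * toℕ k % m   ≡⟨ %-cancelˡ-+ (toℕ i) (cyc-injective-% e) ⟩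
    2 * toℕ l % m   ≡⟨ m<n⇒m%n≡m (below l) ⟩
    2 * toℕ l       ∎))
    where
    below : ∀ k → 2 * toℕ k < m
    below k = <-≤-trans (*-monoʳ-< 2 (toℕ<n k)) 2n≤m

toℕ-punchIn-fromℕ : ∀ n (l : Fin n) → toℕ (punchIn (fromℕ n) l) ≡ toℕ l
toℕ-punchIn-fromℕ (suc n) fzero    = refl
toℕ-punchIn-fromℕ (suc n) (fsuc l) = cong suc (toℕ-punchIn-fromℕ n l)

module _ {V : Set} where

  _enumerates_ : ∀ {n} → (Fin n → V) → (V → Set) → Set
  v enumerates S = ∀ x → (S x → ∃ λ k → x ≡ v k) × ((∃ λ k → x ≡ v k) → S x)

  insertAt-elim : ∀ {n} (P : Fin (suc n) → V → Set) (u : Fin n → V) j w →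
                  P j w → (∀ l → P (punchIn j l) (u l)) → ∀ l → P l (insertAt u j w l)
  insertAt-elim P u j w Pjw Pu l with j ≟ᶠ l
  ... | yes refl = subst (P j) (sym (insertAt-lookup u j w)) Pjw
  ... | no j≢l   = subst (λ l → P l (insertAt u j w l)) (punchIn-punchOut j≢l)
                       (subst (P _) (sym (insertAt-punchIn u j w l′)) (Pu l′))
    where l′ = punchOut j≢l

  insertAt-enumerates : ∀ {n} {u : Fin n → V} {T : V → Set} j w →
                        u enumerates T → insertAt u j w enumerates (λ x → T x ⊎ x ≡ w)
  insertAt-enumerates {u = u} {T} j w u-enum x = into , from
    where
    into : T x ⊎ x ≡ w → ∃ λ l → x ≡ insertAt u j w l
    into (inj₁ Tx) with proj₁ (u-enum x) Tx
    ... | l , refl = punchIn j l , sym (insertAt-punchIn u j w l)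
    into (inj₂ refl) = j , sym (insertAt-lookup u j w)
    from : (∃ λ l → x ≡ insertAt u j w l) → T x ⊎ x ≡ w
    from (l , e) = insertAt-elim (λ _ y → x ≡ y → T x ⊎ x ≡ w) u j w inj₂
                     (λ l x≡ul → inj₁ (proj₂ (u-enum x) (l , x≡ul))) l e

  removeAt-enumerates : ∀ {n} {v : Fin (suc n) → V} {S : V → Set} k →
                        v enumerates S → Injective _≡_ _≡_ v →
                        removeAt v k enumerates (λ x → S x × x ≢ v k)
  removeAt-enumerates {v = v} {S} k v-enum v-inj x = into , from
    where
    into : S x × x ≢ v k → ∃ λ l → x ≡ removeAt v k l
    into (Sx , x≢vk) with proj₁ (v-enum x) Sx
    ... | l , refl = punchOut k≢l , sym (removeAt-punchOut v k≢l)
      where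
      k≢l : k ≢ l
      k≢l refl = x≢vk refl
    from : (∃ λ l → x ≡ removeAt v k l) → S x × x ≢ v k
    from (l , refl) = proj₂ (v-enum x) (punchIn k l , refl) , λ e → punchInᵢ≢i k l (v-inj e)

Π-replace : ∀ {V : Set} {m n} .{{_ : NonZero m}} {A : Fin m → List V} {i i′ : Fin m}
            {S : V → Set} {v : Fin (suc n) → V} →
            (∀ k → v k ∈ A (slot i k)) → v enumerates S → Injective _≡_ _≡_ v →
            ∀ k j {w} → w ∈ A (slot i′ j) →
            (∀ l → slot i′ (punchIn j l) ≡ slot i (punchIn k l)) →
            Π (suc n) A i′ (replace S (v k) w)
Π-replace {A = A} {i′ = i′} {v = v} v∈A v-enum v-inj k j {w} w∈A moved =
  insertAt (removeAt v k) j w ,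
  insertAt-elim (λ l y → y ∈ A (slot i′ l)) (removeAt v k) j w w∈A
    (λ l → subst (λ a → v (punchIn k l) ∈ A a) (sym (moved l)) (v∈A (punchIn k l))) ,
  insertAt-enumerates j w (removeAt-enumerates k v-enum v-inj)

module _ {V : Set} {m : ℕ} .{{_ : NonZero m}} {A : Fin m → List V} (ring : IsRing m A) where

  ∈-class-unique : ∀ {x a b} → x ∈ A a → x ∈ A b → a ≡ b
  ∈-class-unique {x} {a} {b} x∈a x∈b with a ≟ᶠ b
  ... | yes a≡b = a≡b
  ... | no a≢b  = ⊥-elim (IsRing.disjoint ring a b a≢b x x∈a x∈b)

  module _ {n} (2n≤m : 2 * n ≤ m) (i : Fin m) {v : Fin n → V} (v∈A : ∀ k → v k ∈ A (slot i k)) where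

    slot-of-listed : ∀ {k l} → v k ∈ A (slot i l) → k ≡ l
    slot-of-listed {k} h = slot-injective 2n≤m i (∈-class-unique (v∈A k) h)

    listed-injective : Injective _≡_ _≡_ v
    listed-injective {y = l} e = slot-of-listed (subst (_∈ A (slot i l)) (sym e) (v∈A l))

    listed-at-slot : ∀ {S : V → Set} → v enumerates S → ∀ {u} l → S u → u ∈ A (slot i l) → u ≡ v l
    listed-at-slot v-enum {u} l Su u∈A with proj₁ (v-enum u) Su
    ... | k , refl = cong v (slot-of-listed u∈A)

a+[2n∸1]+2[1+t]≡a+2t+m : ∀ p a t → a + (2 * suc p ∸ 1) + 2 * suc t ≡ a + 2 * t + suc (2 * suc p)
a+[2n∸1]+2[1+t]≡a+2t+m p a t = begin
  a + (2 * suc p ∸ 1) + 2 * suc t ≡⟨ cong (λ x → a + (x ∸ 1) + 2 * suc t) (*-suc 2 p) ⟩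
  a + suc (2 * p) + 2 * suc t     ≡⟨ solve p a t ⟩
  a + 2 * t + suc (2 * suc p)     ∎
  where
  solve : ∀ p a t → a + suc (2 * p) + 2 * suc t ≡ a + 2 * t + suc (2 * suc p)
  solve = solve-∀

module _ {V : Set} {p : ℕ} {A : Fin (suc (2 * suc p)) → List V} (ring : IsRing (suc (2 * suc p)) A)
         (i : Fin (suc (2 * suc p))) {S : V → Set} {v : Fin (suc p) → V}
         (v∈A : ∀ k → v k ∈ A (slot i k)) (v-enum : v enumerates S) where

  private
    m = suc (2 * suc p)
    c = toℕ i

    located : ∀ {u} l → S u → u ∈ A (slot i l) → u ≡ v l
    located = listed-at-slot ring (n≤1+n (2 * suc p)) i v∈A v-enum

    injective : Injective _≡_ _≡_ v
    injective = listed-injective ring (n≤1+n (2 * suc p)) i v∈A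

  replace-first : ∀ {u w} → S u → u ∈ A i → w ∈ A (cyc m (c + 2 * suc p)) →
                  Π (suc p) A (cyc m (c + 2)) (replace S u w)
  replace-first {u} {w} Su u∈A w∈A =
    subst (λ u → Π (suc p) A i′ (replace S u w)) (sym (located fzero Su u∈slot))
      (Π-replace {A = A} {i} {i′} v∈A v-enum injective fzero (fromℕ p) w∈slot moved)
    where
    i′ = cyc m (c + 2)
    advance : ∀ t → cyc m (toℕ i′ + 2 * t) ≡ cyc m (c + 2 * suc t)
    advance t = trans (cyc-absorb (c + 2) (2 * t))
                      (cong (cyc m) (trans (+-assoc c 2 (2 * t)) (cong (c +_) (sym (*-suc 2 t)))))
    u∈slot : u ∈ A (slot {n = suc p} i fzero)
    u∈slot = subst (λ a → u ∈ A a) (sym (cyc-toℕ+0 i)) u∈A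
    w∈slot : w ∈ A (slot i′ (fromℕ p))
    w∈slot = subst (λ a → w ∈ A a) (sym (trans (slot-via-toℕ i′ (toℕ-fromℕ p)) (advance p))) w∈A
    moved : ∀ l → slot i′ (punchIn (fromℕ p) l) ≡ slot i (fsuc l)
    moved l = trans (slot-via-toℕ i′ (toℕ-punchIn-fromℕ p l)) (advance (toℕ l))

  replace-last : ∀ {u w} → S u → u ∈ A (cyc m (c + (2 * suc p ∸ 2))) →
                 w ∈ A (cyc m (c + (2 * suc p ∸ 1))) →
                 Π (suc p) A (cyc m (c + (2 * suc p ∸ 1))) (replace S u w)
  replace-last {u} {w} Su u∈A w∈A =
    subst (λ u → Π (suc p) A i′ (replace S u w)) (sym (located (fromℕ p) Su u∈slot))
      (Π-replace {A = A} {i} {i′} v∈A v-enum injective (fromℕ p) fzero w∈slot moved)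
    where
    i′ = cyc m (c + (2 * suc p ∸ 1))
    u∈slot : u ∈ A (slot i (fromℕ p))
    u∈slot = subst (λ a → u ∈ A a)
      (sym (trans (slot-via-toℕ i (toℕ-fromℕ p)) (cong (λ x → cyc m (c + (x ∸ 2))) (sym (*-suc 2 p))))) u∈A
    w∈slot : w ∈ A (slot {n = suc p} i′ fzero)
    w∈slot = subst (λ a → w ∈ A a) (sym (cyc-toℕ+0 i′)) w∈A
    moved : ∀ l → slot i′ (fsuc l) ≡ slot i (punchIn (fromℕ p) l)
    moved l = begin
      cyc m (toℕ i′ + 2 * suc (toℕ l))                  ≡⟨ cyc-absorb (c + (2 * suc p ∸ 1)) _ ⟩
      cyc m (c + (2 * suc p ∸ 1) + 2 * suc (toℕ l))     ≡⟨ cong (cyc m) (a+[2n∸1]+2[1+t]≡a+2t+m p c (toℕ l)) ⟩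
      cyc m (c + 2 * toℕ l + m)                         ≡⟨ cyc-+-modulus (c + 2 * toℕ l) ⟩
      cyc m (c + 2 * toℕ l)                             ≡⟨ slot-via-toℕ i (toℕ-punchIn-fromℕ p l) ⟨
      slot i (punchIn (fromℕ p) l)                      ∎

lemma2p13 : {V : Set} (n : ℕ) → 2 ≤ n →
    (A : Fin (suc (2 * n)) → List V) → IsRing (suc (2 * n)) A →
    (i : Fin (suc (2 * n))) → (S : V → Set) → Π n A i S →
    (∀ u → S u → u ∈ A i →
    ∀ w → w ∈ A (cyc (suc (2 * n)) (toℕ i + 2 * n)) →
    Π n A (cyc (suc (2 * n)) (toℕ i + 2)) (replace S u w))
    × (∀ u → S u → u ∈ A (cyc (suc (2 * n)) (toℕ i + (2 * n ∸ 2))) →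
    ∀ w → w ∈ A (cyc (suc (2 * n)) (toℕ i + (2 * n ∸ 1))) →
    Π n A (cyc (suc (2 * n)) (toℕ i + (2 * n ∸ 1))) (replace S u w))
lemma2p13 (suc p) _ A ring i S (v , v∈A , v-enum) =
  (λ u Su u∈A w w∈A → replace-first ring i v∈A v-enum Su u∈A w∈A) ,
  (λ u Su u∈A w w∈A → replace-last ring i v∈A v-enum Su u∈A w∈A)
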